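{- Let $\lambda\in\Lambda^+$ be a dominant weight. Then every vertex of $\mathsf{P}^+(\lambda)$ lies in $\mathbb{Z}[\frac{1}{(n+1)!}]\Phi$, the set of $\mathbb{Z}[\frac{1}{(n+1)!}]$-linear combinations of roots.
   Context: Fix $n\ge1$; type $A_n$: $E=\{x\in\mathbb{R}^{n+1}:\sum x_i=0\}$ with standard inner product, $\Phi=\{\varepsilon_i-\varepsilon_j:i\ne j\}$, simple roots $\alpha_i=\varepsilon_i-\varepsilon_{i+1}$, fundamental weights $\varpi_i$ with $\langle\varpi_i,\alpha_j\rangle=\delta_{ij}$, $\Lambda=\bigoplus\mathbb{Z}\varpi_i$, $\Lambda^+=\{\lambda\in\Lambda:\langle\lambda,\alpha_i\rangle\ge0\ \forall i\}$, $C^+=\{x\in E:\langle x,\alpha_i\rangle\ge0\ \forall i\}$. $W_{\mathrm f}\cong S_{n+1}$ is the finite Weyl group acting on $E$ by permuting coordinates. $\mathsf{P}(\lambda)=\mathrm{Conv}(W_{\mathrm f}\cdot\lambda)$, $\mathsf{P}^+(\lambda)=\mathsf{P}(\lambda)\cap C^+$.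
   Formalization: The space E is taken inside ℚ^(n+1) instead of $\mathbb{R}^{n+1}$, so $\mathsf{P}^+(\lambda)$ and its vertices are formed from rational points and rational convex combinations. -}

module Defs where

open import Data.Nat as ℕ using (ℕ; zero; suc)

open import Data.Integer as ℤ using (ℤ)
open import Data.Rational using (ℚ; 0ℚ; 1ℚ; _+_; _*_; _-_; _≤_; _<_; _/_)
open import Data.Fin using (Fin; inject₁) renaming (zero to fzero; suc to fsuc)
open import Data.Fin.Permutation using (Permutation′; _⟨$⟩ʳ_)
open import Data.List using (List; []; _∷_)
open import Data.List.Relation.Unary.All using (All)
open import Data.Product using (_×_; _,_; Σ; ∃; proj₁; proj₂)
open import Relation.Binary.PropositionalEquality using (_≡_)
open import Relation.Nullary using (Dec; yes; no)
open import Data.Fin using (_≟_)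

-- Points of ℚ^(n+1) (the ambient space of type A_n has dimension n+1).
Pt : ℕ → Set
Pt n = Fin (suc n) → ℚ

_≋_ : ∀ {n} → Pt n → Pt n → Set
x ≋ y = ∀ k → x k ≡ y k

Σᶠ : ∀ {m} → (Fin m → ℚ) → ℚ
Σᶠ {zero} f = 0ℚ
Σᶠ {suc m} f = f fzero + Σᶠ (λ i → f (fsuc i))

InE : ∀ {n} → Pt n → Set
InE x = Σᶠ x ≡ 0ℚ

-- ⟨x , α_i⟩ with α_i = ε_i − ε_{i+1}, i : Fin n (simple roots α_1..α_n)
⟨_,α_⟩ : ∀ {n} → Pt n → Fin n → ℚ
⟨ x ,α i ⟩ = x (inject₁ i) - x (fsuc i)

ℕ→ℚ : ℕ → ℚ
ℕ→ℚ k = ℤ.+ k / 1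

ℤ→ℚ : ℤ → ℚ
ℤ→ℚ z = z / 1

-- Weight lattice Λ = ⊕ ℤ ϖ_i : points of E whose pairings with all simple
-- roots are integers (ϖ_i is the basis dual to the α_j inside E).
DominantWeight : ∀ {n} → Pt n → Set
DominantWeight {n} λ' = InE λ' × (∀ (i : Fin n) → ∃ λ (k : ℕ) → ⟨ λ' ,α i ⟩ ≡ ℕ→ℚ k)

InC⁺ : ∀ {n} → Pt n → Set
InC⁺ {n} x = InE x × (∀ (i : Fin n) → 0ℚ ≤ ⟨ x ,α i ⟩)

-- Action of w ∈ W_f ≅ S_{n+1} by permuting coordinates
act : ∀ {n} → Permutation′ (suc n) → Pt n → Pt n
act σ x k = x (σ ⟨$⟩ʳ k)

sumCoeffs : ∀ {n} → List (ℚ × Permutation′ (suc n)) → ℚ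
sumCoeffs [] = 0ℚ
sumCoeffs ((c , _) ∷ L) = c + sumCoeffs L

combo : ∀ {n} → List (ℚ × Permutation′ (suc n)) → Pt n → Pt n
combo [] λ' k = 0ℚ
combo ((c , σ) ∷ L) λ' k = c * act σ λ' k + combo L λ' k

InP : ∀ {n} → Pt n → Pt n → Set
InP {n} λ' p = ∃ λ (L : List (ℚ × Permutation′ (suc n))) →
  All (λ cσ → 0ℚ ≤ proj₁ cσ) L × sumCoeffs L ≡ 1ℚ × (p ≋ combo L λ')

InP⁺ : ∀ {n} → Pt n → Pt n → Set
InP⁺ λ' p = InP λ' p × InC⁺ p

IsVertexP⁺ : ∀ {n} → Pt n → Pt n → Set
IsVertexP⁺ λ' v = InP⁺ λ' v ×
  (∀ a b (t : ℚ) → InP⁺ λ' a → InP⁺ λ' b → 0ℚ < t → t < 1ℚ →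
     v ≋ (λ k → t * a k + (1ℚ - t) * b k) → a ≋ b)

InZInv : ℕ → ℚ → Set
InZInv N q = ∃ λ (z : ℤ) → ∃ λ (e : ℕ) → q * ℕ→ℚ (N ℕ.^ e) ≡ ℤ→ℚ z

δ : ∀ {n} → Fin n → Fin n → ℚ
δ i k with i ≟ k
... | yes _ = 1ℚ
... | no _ = 0ℚ

root : ∀ {n} → Fin (suc n) → Fin (suc n) → Pt n
root i j k = δ i k - δ j k

-- ℤ[1/N]Φ: ℤ[1/N]-linear combinations Σ_{i,j} c_{ij} (ε_i − ε_j) of roots
-- (diagonal terms i = j contribute the zero vector and are harmless)
InZInvΦ : ∀ {n} → ℕ → Pt n → Set
InZInvΦ {n} N x = ∃ λ (c : Fin (suc n) → Fin (suc n) → ℚ) →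
  (∀ i j → InZInv N (c i j)) ×
  (x ≋ (λ k → Σᶠ (λ i → Σᶠ (λ j → c i j * root i j k))))

{-# OPTIONS --safe #-}
-- Let u = σλ be an orbit point with positive weight in a convex combination representing the
-- vertex v, and let S average a point over the level sets of v.  S is a composition of moves
-- z ↦ (1 - t) z + t (z ∘ (i j)) with vᵢ = vⱼ and t = 1/d, d ≤ n + 1; hence S is affine, fixes v,
-- maps P(λ) into itself and preserves coordinates in ℤ[1/(n+1)!].  For small ε > 0 both
-- v ± ε (S u - v) lie in P⁺(λ): the minus sign because (1 + ε) v - ε u is still a convex
-- combination of the orbit, and the chamber inequalities because S u is constant on the ties
-- of v.  Since v is their midpoint, v = S u.  The coordinates of a dominant weight, hence those
-- of S u, lie in ℤ[1/(n+1)], and a point of E with coordinates in a ring R lies in RΦ.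

module Submission where

open import Defs
open import Data.Nat using (ℕ; suc; _!)

open import Data.Fin using (Fin; inject₁) renaming (zero to fzero; suc to fsuc; _≟_ to _≟ᶠ_)
import Data.Fin.Properties as Fin
open import Data.Fin.Permutation using (Permutation′; _⟨$⟩ʳ_; _∘ₚ_; transpose)
open import Data.Integer as ℤ using (ℤ)
import Data.Integer.Properties as ℤ
open import Data.List using (List; []; _∷_; _++_; map; length; filter; allFin)
open import Data.List.Membership.Propositional using (_∈_; _∉_)
open import Data.List.Membership.Propositional.Properties using (∈-filter⁺; ∈-filter⁻; ∈-allFin)
open import Data.List.Properties using (length-filter; length-tabulate)
open import Data.List.Relation.Unary.All as All using (All; []; _∷_)
import Data.List.Relation.Unary.All.Properties as AllP
open import Data.List.Relation.Unary.AllPairs using () renaming (tail to Unique-tail)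
open import Data.List.Relation.Unary.Any using (here; there)
open import Data.List.Relation.Unary.Unique.Propositional using (Unique)
open import Data.List.Relation.Unary.Unique.Propositional.Properties using (Unique[x∷xs]⇒x∉xs; filter⁺; allFin⁺)
open import Data.Nat as ℕ using (zero)
open import Data.Nat.Divisibility using (_∣_; divides; ∣-trans; m∣m*n; m≤n⇒m!∣n!)
import Data.Nat.Properties as ℕ
open import Data.Product using (_×_; _,_; ∃; ∃₂; proj₁; proj₂)
open import Data.Rational
  using (ℚ; 0ℚ; 1ℚ; ½; *<*; _+_; _*_; _-_; -_; _≤_; _<_; _/_; 1/_; ∣_∣; _⊓_; toℚᵘ; NonZero; Positive; positive; nonNegative; ≢-nonZero)
open import Data.Rational.Properties
open import Data.Rational.Solver using (module +-*-Solver)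
open import Data.Rational.Unnormalised as ℚᵘ using (mkℚᵘ; *≡*)
import Data.Rational.Unnormalised.Properties as ℚᵘ
open import Data.Sum using (inj₁; inj₂)
open import Function using (_∘_; id)
open import Relation.Binary.PropositionalEquality
open import Relation.Nullary using (Dec; yes; no; contradiction)
open import Relation.Nullary.Decidable using (dec-true; dec-false)
import Algebra.Properties.CommutativeMonoid.Sum as CommutativeMonoidSum
open import Algebra.Properties.Group +-0-group using (x∙y⁻¹≈ε⇒x≈y)

open +-*-Solver using (solve; _:+_; _:*_; _:-_; :-_; _:=_; con)

module Sum = CommutativeMonoidSum +-0-commutativeMonoid

toℚᵘ-ℤ→ℚ : ∀ z → toℚᵘ (ℤ→ℚ z) ℚᵘ.≃ mkℚᵘ z 0
toℚᵘ-ℤ→ℚ z = toℚᵘ-fromℚᵘ (mkℚᵘ z 0)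

mkℚᵘ-homo-+ : ∀ a b → mkℚᵘ (a ℤ.+ b) 0 ℚᵘ.≃ mkℚᵘ a 0 ℚᵘ.+ mkℚᵘ b 0
mkℚᵘ-homo-+ a b = *≡* (trans (ℤ.*-identityʳ (a ℤ.+ b)) (sym (trans (ℤ.*-identityʳ _) (cong₂ ℤ._+_ (ℤ.*-identityʳ a) (ℤ.*-identityʳ b)))))

mkℚᵘ-homo-* : ∀ a b → mkℚᵘ (a ℤ.* b) 0 ℚᵘ.≃ mkℚᵘ a 0 ℚᵘ.* mkℚᵘ b 0
mkℚᵘ-homo-* a b = *≡* refl

ℤ→ℚ-homo-+ : ∀ a b → ℤ→ℚ (a ℤ.+ b) ≡ ℤ→ℚ a + ℤ→ℚ b
ℤ→ℚ-homo-+ a b = toℚᵘ-injective (begin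
  toℚᵘ (ℤ→ℚ (a ℤ.+ b))             ≈⟨ toℚᵘ-ℤ→ℚ (a ℤ.+ b) ⟩
  mkℚᵘ (a ℤ.+ b) 0                  ≈⟨ mkℚᵘ-homo-+ a b ⟩
  mkℚᵘ a 0 ℚᵘ.+ mkℚᵘ b 0            ≈⟨ ℚᵘ.+-cong (toℚᵘ-ℤ→ℚ a) (toℚᵘ-ℤ→ℚ b) ⟨
  toℚᵘ (ℤ→ℚ a) ℚᵘ.+ toℚᵘ (ℤ→ℚ b)    ≈⟨ toℚᵘ-homo-+ (ℤ→ℚ a) (ℤ→ℚ b) ⟨
  toℚᵘ (ℤ→ℚ a + ℤ→ℚ b)              ∎)
  where open ℚᵘ.≃-Reasoning

ℤ→ℚ-homo-* : ∀ a b → ℤ→ℚ (a ℤ.* b) ≡ ℤ→ℚ a * ℤ→ℚ b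
ℤ→ℚ-homo-* a b = toℚᵘ-injective (begin
  toℚᵘ (ℤ→ℚ (a ℤ.* b))             ≈⟨ toℚᵘ-ℤ→ℚ (a ℤ.* b) ⟩
  mkℚᵘ (a ℤ.* b) 0                  ≈⟨ mkℚᵘ-homo-* a b ⟩
  mkℚᵘ a 0 ℚᵘ.* mkℚᵘ b 0            ≈⟨ ℚᵘ.*-cong (toℚᵘ-ℤ→ℚ a) (toℚᵘ-ℤ→ℚ b) ⟨
  toℚᵘ (ℤ→ℚ a) ℚᵘ.* toℚᵘ (ℤ→ℚ b)    ≈⟨ toℚᵘ-homo-* (ℤ→ℚ a) (ℤ→ℚ b) ⟨
  toℚᵘ (ℤ→ℚ a * ℤ→ℚ b)              ∎)
  where open ℚᵘ.≃-Reasoning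

ℤ→ℚ-homo-neg : ∀ a → ℤ→ℚ (ℤ.- a) ≡ - ℤ→ℚ a
ℤ→ℚ-homo-neg a = toℚᵘ-injective (begin
  toℚᵘ (ℤ→ℚ (ℤ.- a))     ≈⟨ toℚᵘ-ℤ→ℚ (ℤ.- a) ⟩
  mkℚᵘ (ℤ.- a) 0          ≈⟨ *≡* refl ⟩
  ℚᵘ.- mkℚᵘ a 0           ≈⟨ ℚᵘ.-‿cong (toℚᵘ-ℤ→ℚ a) ⟨
  ℚᵘ.- toℚᵘ (ℤ→ℚ a)       ≈⟨ toℚᵘ-homo‿- (ℤ→ℚ a) ⟨
  toℚᵘ (- ℤ→ℚ a)          ∎)
  where open ℚᵘ.≃-Reasoning

ℕ→ℚ-homo-+ : ∀ a b → ℕ→ℚ (a ℕ.+ b) ≡ ℕ→ℚ a + ℕ→ℚ b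
ℕ→ℚ-homo-+ a b = trans (cong ℤ→ℚ (ℤ.pos-+ a b)) (ℤ→ℚ-homo-+ (ℤ.+ a) (ℤ.+ b))

ℕ→ℚ-homo-* : ∀ a b → ℕ→ℚ (a ℕ.* b) ≡ ℕ→ℚ a * ℕ→ℚ b
ℕ→ℚ-homo-* a b = trans (cong ℤ→ℚ (ℤ.pos-* a b)) (ℤ→ℚ-homo-* (ℤ.+ a) (ℤ.+ b))

ℕ→ℚ-suc : ∀ m → ℕ→ℚ (suc m) ≡ ℕ→ℚ m + 1ℚ
ℕ→ℚ-suc m = trans (cong ℕ→ℚ (ℕ.+-comm 1 m)) (ℕ→ℚ-homo-+ m 1)

ℕ→ℚ-*-1/ : ∀ m → ℕ→ℚ (suc m) * (ℤ.+ 1 / suc m) ≡ 1ℚ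
ℕ→ℚ-*-1/ m = toℚᵘ-injective (begin
  toℚᵘ (ℕ→ℚ (suc m) * (ℤ.+ 1 / suc m))                ≈⟨ toℚᵘ-homo-* (ℕ→ℚ (suc m)) (ℤ.+ 1 / suc m) ⟩
  toℚᵘ (ℕ→ℚ (suc m)) ℚᵘ.* toℚᵘ (ℤ.+ 1 / suc m)        ≈⟨ ℚᵘ.*-cong (toℚᵘ-ℤ→ℚ (ℤ.+ suc m)) (toℚᵘ-fromℚᵘ (mkℚᵘ (ℤ.+ 1) m)) ⟩
  mkℚᵘ (ℤ.+ suc m) 0 ℚᵘ.* mkℚᵘ (ℤ.+ 1) m              ≈⟨ *≡* (cong (λ k → ℤ.+ suc k) m*1*1≡m+0+0) ⟩
  toℚᵘ 1ℚ                                              ∎)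
  where
  open ℚᵘ.≃-Reasoning
  m*1*1≡m+0+0 : m ℕ.* 1 ℕ.* 1 ≡ m ℕ.+ 0 ℕ.+ 0
  m*1*1≡m+0+0 = trans (ℕ.*-identityʳ (m ℕ.* 1)) (trans (ℕ.*-identityʳ m) (sym (trans (ℕ.+-identityʳ (m ℕ.+ 0)) (ℕ.+-identityʳ m))))

ℕ→ℚ-^-+ : ∀ N a b → ℕ→ℚ (N ℕ.^ (a ℕ.+ b)) ≡ ℕ→ℚ (N ℕ.^ a) * ℕ→ℚ (N ℕ.^ b)
ℕ→ℚ-^-+ N a b = trans (cong ℕ→ℚ (ℕ.^-distribˡ-+-* N a b)) (ℕ→ℚ-homo-* (N ℕ.^ a) (N ℕ.^ b))

-- The ring solver cannot use hypotheses; an identity that holds because u ≡ 1ℚ is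
-- proved by the solver in the form P ≡ Q + (u - 1ℚ) * K.
≡-via-unit : ∀ {u} P Q K → u ≡ 1ℚ → P ≡ Q + (u - 1ℚ) * K → P ≡ Q
≡-via-unit P Q K refl P≡ = trans P≡ (vanish Q K)
  where
  vanish : ∀ Q K → Q + (1ℚ - 1ℚ) * K ≡ Q
  vanish = solve 2 (λ Q K → Q :+ (con 1ℚ :- con 1ℚ) :* K := Q) refl

0≤* : ∀ {p q} → 0ℚ ≤ p → 0ℚ ≤ q → 0ℚ ≤ p * q
0≤* {p} {q} 0≤p 0≤q = nonNegative⁻¹ (p * q) {{nonNeg*nonNeg⇒nonNeg p {{nonNegative 0≤p}} q {{nonNegative 0≤q}}}}

0≤+ : ∀ {p q} → 0ℚ ≤ p → 0ℚ ≤ q → 0ℚ ≤ p + q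
0≤+ {p} {q} 0≤p 0≤q = nonNegative⁻¹ (p + q) {{nonNeg+nonNeg⇒nonNeg p {{nonNegative 0≤p}} q {{nonNegative 0≤q}}}}

0≤q-p⇒p≤q : ∀ {p q} → 0ℚ ≤ q - p → p ≤ q
0≤q-p⇒p≤q {p} {q} 0≤q-p = subst₂ _≤_ (+-identityˡ p) (cancel q p) (+-monoˡ-≤ p 0≤q-p)
  where
  cancel : ∀ q p → q - p + p ≡ q
  cancel = solve 2 (λ q p → q :- p :+ p := q) refl

p≤q⇒0≤q-p : ∀ {p q} → p ≤ q → 0ℚ ≤ q - p
p≤q⇒0≤q-p {p} {q} p≤q = subst (_≤ q - p) (+-inverseʳ p) (+-monoˡ-≤ (- p) p≤q)

0<p⇒p*q≡0⇒q≡0 : ∀ {p q} → 0ℚ < p → p * q ≡ 0ℚ → q ≡ 0ℚ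
0<p⇒p*q≡0⇒q≡0 {p} {q} 0<p p*q≡0 = begin
  q                  ≡⟨ *-identityˡ q ⟨
  1ℚ * q             ≡⟨ cong (_* q) (*-inverseˡ p) ⟨
  1/ p * p * q       ≡⟨ *-assoc (1/ p) p q ⟩
  1/ p * (p * q)     ≡⟨ cong (1/ p *_) p*q≡0 ⟩
  1/ p * 0ℚ          ≡⟨ *-zeroʳ (1/ p) ⟩
  0ℚ                 ∎
  where
  open ≡-Reasoning
  instance
    p≢0 : NonZero p
    p≢0 = pos⇒nonZero p {{positive 0<p}}

0≤∣p∣+p : ∀ p → 0ℚ ≤ ∣ p ∣ + p
0≤∣p∣+p p with ∣p∣≡p∨∣p∣≡-p p
... | inj₁ ∣p∣≡p = subst (λ x → 0ℚ ≤ ∣ p ∣ + x) ∣p∣≡p (0≤+ (0≤∣p∣ p) (0≤∣p∣ p))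
... | inj₂ ∣p∣≡-p = ≤-reflexive (sym (trans (cong (_+ p) ∣p∣≡-p) (+-inverseˡ p)))

ε∣h∣≤g⇒0≤g+εh : ∀ {g ε h} → 0ℚ ≤ ε → ε * ∣ h ∣ ≤ g → 0ℚ ≤ g + ε * h
ε∣h∣≤g⇒0≤g+εh {g} {ε} {h} 0≤ε ε∣h∣≤g =
  subst (0ℚ ≤_) (split g ε ∣ h ∣ h) (0≤+ (p≤q⇒0≤q-p ε∣h∣≤g) (0≤* 0≤ε (0≤∣p∣+p h)))
  where
  split : ∀ g ε a h → (g - ε * a) + ε * (a + h) ≡ g + ε * h
  split = solve 4 (λ g ε a h → (g :- ε :* a) :+ ε :* (a :+ h) := g :+ ε :* h) refl

InZInv-ℤ : ∀ N z → InZInv N (ℤ→ℚ z)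
InZInv-ℤ N z = z , 0 , *-identityʳ (ℤ→ℚ z)

InZInv-+ : ∀ N {p q} → InZInv N p → InZInv N q → InZInv N (p + q)
InZInv-+ N {p} {q} (a , e , pN≡a) (b , f , qN≡b) = a ℤ.* B ℤ.+ b ℤ.* A , e ℕ.+ f , (begin
  (p + q) * ℕ→ℚ (N ℕ.^ (e ℕ.+ f))              ≡⟨ cong ((p + q) *_) (ℕ→ℚ-^-+ N e f) ⟩
  (p + q) * (ℤ→ℚ A * ℤ→ℚ B)                    ≡⟨ distrib p q (ℤ→ℚ A) (ℤ→ℚ B) ⟩
  p * ℤ→ℚ A * ℤ→ℚ B + q * ℤ→ℚ B * ℤ→ℚ A        ≡⟨ cong₂ (λ x y → x * ℤ→ℚ B + y * ℤ→ℚ A) pN≡a qN≡b ⟩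
  ℤ→ℚ a * ℤ→ℚ B + ℤ→ℚ b * ℤ→ℚ A                ≡⟨ cong₂ _+_ (ℤ→ℚ-homo-* a B) (ℤ→ℚ-homo-* b A) ⟨
  ℤ→ℚ (a ℤ.* B) + ℤ→ℚ (b ℤ.* A)                ≡⟨ ℤ→ℚ-homo-+ (a ℤ.* B) (b ℤ.* A) ⟨
  ℤ→ℚ (a ℤ.* B ℤ.+ b ℤ.* A)                    ∎)
  where
  open ≡-Reasoning
  A = ℤ.+ (N ℕ.^ e)
  B = ℤ.+ (N ℕ.^ f)
  distrib : ∀ p q x y → (p + q) * (x * y) ≡ p * x * y + q * y * x
  distrib = solve 4 (λ p q x y → (p :+ q) :* (x :* y) := p :* x :* y :+ q :* y :* x) refl

InZInv-* : ∀ N {p q} → InZInv N p → InZInv N q → InZInv N (p * q)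
InZInv-* N {p} {q} (a , e , pN≡a) (b , f , qN≡b) = a ℤ.* b , e ℕ.+ f , (begin
  p * q * ℕ→ℚ (N ℕ.^ (e ℕ.+ f))                          ≡⟨ cong (p * q *_) (ℕ→ℚ-^-+ N e f) ⟩
  p * q * (ℕ→ℚ (N ℕ.^ e) * ℕ→ℚ (N ℕ.^ f))                ≡⟨ regroup p q (ℕ→ℚ (N ℕ.^ e)) (ℕ→ℚ (N ℕ.^ f)) ⟩
  p * ℕ→ℚ (N ℕ.^ e) * (q * ℕ→ℚ (N ℕ.^ f))                ≡⟨ cong₂ _*_ pN≡a qN≡b ⟩
  ℤ→ℚ a * ℤ→ℚ b                                          ≡⟨ ℤ→ℚ-homo-* a b ⟨
  ℤ→ℚ (a ℤ.* b)                                          ∎)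
  where
  open ≡-Reasoning
  regroup : ∀ p q x y → p * q * (x * y) ≡ p * x * (q * y)
  regroup = solve 4 (λ p q x y → p :* q :* (x :* y) := p :* x :* (q :* y)) refl

InZInv-neg : ∀ N {p} → InZInv N p → InZInv N (- p)
InZInv-neg N {p} (a , e , pN≡a) =
  ℤ.- a , e , trans (sym (neg-distribˡ-* p _)) (trans (cong -_ pN≡a) (sym (ℤ→ℚ-homo-neg a)))

InZInv-1/ : ∀ N d → suc d ∣ N → InZInv N (ℤ.+ 1 / suc d)
InZInv-1/ N d (divides k N≡k*d) = ℤ.+ k , 1 , (begin
  t * ℕ→ℚ (N ℕ.^ 1)                      ≡⟨ cong (λ x → t * ℕ→ℚ x) (trans (ℕ.*-identityʳ N) N≡k*d) ⟩
  t * ℕ→ℚ (k ℕ.* suc d)                  ≡⟨ cong (t *_) (ℕ→ℚ-homo-* k (suc d)) ⟩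
  t * (ℕ→ℚ k * ℕ→ℚ (suc d))              ≡⟨ regroup t (ℕ→ℚ k) (ℕ→ℚ (suc d)) ⟩
  ℕ→ℚ k * (ℕ→ℚ (suc d) * t)              ≡⟨ cong (ℕ→ℚ k *_) (ℕ→ℚ-*-1/ d) ⟩
  ℕ→ℚ k * 1ℚ                             ≡⟨ *-identityʳ (ℕ→ℚ k) ⟩
  ℕ→ℚ k                                  ∎)
  where
  open ≡-Reasoning
  t = ℤ.+ 1 / suc d
  regroup : ∀ t x y → t * (x * y) ≡ x * (y * t)
  regroup = solve 3 (λ t x y → t :* (x :* y) := x :* (y :* t)) refl

InZInv-Σᶠ : ∀ N {m} (f : Fin m → ℚ) → (∀ i → InZInv N (f i)) → InZInv N (Σᶠ f)
InZInv-Σᶠ N {zero} f _ = InZInv-ℤ N (ℤ.+ 0)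
InZInv-Σᶠ N {suc m} f h = InZInv-+ N {f fzero} (h fzero) (InZInv-Σᶠ N (λ i → f (fsuc i)) (λ i → h (fsuc i)))

InZInv-along : ∀ N x t y → InZInv N x → InZInv N t → InZInv N y → InZInv N (x + t * (y - x))
InZInv-along N x t y hx ht hy =
  InZInv-+ N {x} hx (InZInv-* N {t} ht (InZInv-+ N {y} hy (InZInv-neg N {x} hx)))

Σᶠ-cong : ∀ {m} {f g : Fin m → ℚ} → (∀ i → f i ≡ g i) → Σᶠ f ≡ Σᶠ g
Σᶠ-cong {zero} f≗g = refl
Σᶠ-cong {suc m} f≗g = cong₂ _+_ (f≗g fzero) (Σᶠ-cong (λ i → f≗g (fsuc i)))

Σᶠ-distrib-+ : ∀ {m} (f g : Fin m → ℚ) → Σᶠ (λ i → f i + g i) ≡ Σᶠ f + Σᶠ g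
Σᶠ-distrib-+ {zero} f g = refl
Σᶠ-distrib-+ {suc m} f g = begin
  f fzero + g fzero + Σᶠ (λ i → f (fsuc i) + g (fsuc i))    ≡⟨ cong (f fzero + g fzero +_) (Σᶠ-distrib-+ (λ i → f (fsuc i)) (λ i → g (fsuc i))) ⟩
  f fzero + g fzero + (Σᶠ (λ i → f (fsuc i)) + Σᶠ (λ i → g (fsuc i)))  ≡⟨ +-interchange (f fzero) (g fzero) (Σᶠ (λ i → f (fsuc i))) (Σᶠ (λ i → g (fsuc i))) ⟩
  f fzero + Σᶠ (λ i → f (fsuc i)) + (g fzero + Σᶠ (λ i → g (fsuc i)))  ∎
  where
  open ≡-Reasoning
  +-interchange : ∀ a b c d → a + b + (c + d) ≡ a + c + (b + d)
  +-interchange = solve 4 (λ a b c d → a :+ b :+ (c :+ d) := a :+ c :+ (b :+ d)) refl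

Σᶠ-distribˡ-* : ∀ {m} c (f : Fin m → ℚ) → Σᶠ (λ i → c * f i) ≡ c * Σᶠ f
Σᶠ-distribˡ-* {zero} c f = sym (*-zeroʳ c)
Σᶠ-distribˡ-* {suc m} c f =
  trans (cong (c * f fzero +_) (Σᶠ-distribˡ-* c (λ i → f (fsuc i)))) (sym (*-distribˡ-+ c (f fzero) _))

Σᶠ-const : ∀ {m} c → Σᶠ {m} (λ _ → c) ≡ ℕ→ℚ m * c
Σᶠ-const {zero} c = sym (*-zeroˡ c)
Σᶠ-const {suc m} c = begin
  c + Σᶠ {m} (λ _ → c)     ≡⟨ cong (c +_) (Σᶠ-const {m} c) ⟩
  c + ℕ→ℚ m * c           ≡⟨ +-*-suc c (ℕ→ℚ m) ⟩
  (ℕ→ℚ m + 1ℚ) * c        ≡⟨ cong (_* c) (ℕ→ℚ-suc m) ⟨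
  ℕ→ℚ (suc m) * c         ∎
  where
  open ≡-Reasoning
  +-*-suc : ∀ c m → c + m * c ≡ (m + 1ℚ) * c
  +-*-suc = solve 2 (λ c m → c :+ m :* c := (m :+ con 1ℚ) :* c) refl

Σᶠ-zero : ∀ {m} → Σᶠ {m} (λ _ → 0ℚ) ≡ 0ℚ
Σᶠ-zero {m} = trans (Σᶠ-const {m} 0ℚ) (*-zeroʳ (ℕ→ℚ m))

Σᶠ≡sum : ∀ {m} (f : Fin m → ℚ) → Σᶠ f ≡ Sum.sum f
Σᶠ≡sum {zero} f = refl
Σᶠ≡sum {suc m} f = cong (f fzero +_) (Σᶠ≡sum (λ i → f (fsuc i)))

Σᶠ-permute : ∀ {m} (f : Fin m → ℚ) (π : Permutation′ m) → Σᶠ (λ i → f (π ⟨$⟩ʳ i)) ≡ Σᶠ f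
Σᶠ-permute f π = begin
  Σᶠ (λ i → f (π ⟨$⟩ʳ i))     ≡⟨ Σᶠ≡sum (λ i → f (π ⟨$⟩ʳ i)) ⟩
  Sum.sum (λ i → f (π ⟨$⟩ʳ i)) ≡⟨ Sum.sum-permute f π ⟨
  Sum.sum f                    ≡⟨ Σᶠ≡sum f ⟨
  Σᶠ f                         ∎
  where open ≡-Reasoning

δ-diag : ∀ {m} (k : Fin m) → δ k k ≡ 1ℚ
δ-diag k with k ≟ᶠ k
... | yes _ = refl
... | no k≢k = contradiction refl k≢k

δ-off : ∀ {m} (i k : Fin m) → i ≢ k → δ i k ≡ 0ℚ
δ-off i k i≢k with i ≟ᶠ k
... | yes i≡k = contradiction i≡k i≢k
... | no _ = refl

δ-suc : ∀ {m} (i k : Fin m) → δ (fsuc i) (fsuc k) ≡ δ i k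
δ-suc i k = by-cases (i ≟ᶠ k)
  where
  by-cases : Dec (i ≡ k) → δ (fsuc i) (fsuc k) ≡ δ i k
  by-cases (yes refl) = trans (δ-diag (fsuc i)) (sym (δ-diag i))
  by-cases (no i≢k) = trans (δ-off (fsuc i) (fsuc k) (i≢k ∘ Fin.suc-injective)) (sym (δ-off i k i≢k))

Σᶠ-δ : ∀ {m} (f : Fin m → ℚ) k → Σᶠ (λ i → f i * δ i k) ≡ f k
Σᶠ-δ {suc m} f fzero = begin
  f fzero * δ {suc m} fzero fzero + Σᶠ (λ i → f (fsuc i) * δ (fsuc i) fzero)
    ≡⟨ cong₂ _+_ (cong (f fzero *_) (δ-diag {suc m} fzero)) (Σᶠ-cong (λ i → trans (cong (f (fsuc i) *_) (δ-off (fsuc i) fzero λ ())) (*-zeroʳ (f (fsuc i))))) ⟩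
  f fzero * 1ℚ + Σᶠ {m} (λ _ → 0ℚ)
    ≡⟨ cong₂ _+_ (*-identityʳ (f fzero)) (Σᶠ-zero {m}) ⟩
  f fzero + 0ℚ
    ≡⟨ +-identityʳ (f fzero) ⟩
  f fzero ∎
  where open ≡-Reasoning
Σᶠ-δ {suc m} f (fsuc k) = begin
  f fzero * δ fzero (fsuc k) + Σᶠ (λ i → f (fsuc i) * δ (fsuc i) (fsuc k))
    ≡⟨ cong₂ _+_ (trans (cong (f fzero *_) (δ-off fzero (fsuc k) λ ())) (*-zeroʳ (f fzero))) (Σᶠ-cong (λ i → cong (f (fsuc i) *_) (δ-suc i k))) ⟩
  0ℚ + Σᶠ (λ i → f (fsuc i) * δ i k)
    ≡⟨ +-identityˡ _ ⟩
  Σᶠ (λ i → f (fsuc i) * δ i k)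
    ≡⟨ Σᶠ-δ (λ i → f (fsuc i)) k ⟩
  f (fsuc k) ∎
  where open ≡-Reasoning

-- The convex hull of the Weyl orbit

along : ∀ {n} → Pt n → ℚ → Pt n → Pt n
along x t y k = x k + t * (y k - x k)

along-cong : ∀ {n} {x x′ y y′ : Pt n} t → x ≋ x′ → y ≋ y′ → along x t y ≋ along x′ t y′
along-cong t x≋x′ y≋y′ k = cong₂ (λ a b → a + t * (b - a)) (x≋x′ k) (y≋y′ k)

along-refl : ∀ {n} (x : Pt n) t → along x t x ≋ x
along-refl x t k = stays t (x k)
  where
  stays : ∀ t a → a + t * (a - a) ≡ a
  stays = solve 2 (λ t a → a :+ t :* (a :- a) := a) refl

Coeffs : ℕ → Set
Coeffs n = List (ℚ × Permutation′ (suc n))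

NonNegCoeffs : ∀ {n} → Coeffs n → Set
NonNegCoeffs = All (λ cσ → 0ℚ ≤ proj₁ cσ)

scaleCoeffs : ∀ {n} → ℚ → Coeffs n → Coeffs n
scaleCoeffs t = map (λ (c , σ) → t * c , σ)

precomposeCoeffs : ∀ {n} → Permutation′ (suc n) → Coeffs n → Coeffs n
precomposeCoeffs τ = map (λ (c , σ) → c , τ ∘ₚ σ)

sumCoeffs-++ : ∀ {n} (L M : Coeffs n) → sumCoeffs (L ++ M) ≡ sumCoeffs L + sumCoeffs M
sumCoeffs-++ [] M = sym (+-identityˡ (sumCoeffs M))
sumCoeffs-++ ((c , _) ∷ L) M = trans (cong (c +_) (sumCoeffs-++ L M)) (sym (+-assoc c (sumCoeffs L) (sumCoeffs M)))

sumCoeffs-scale : ∀ {n} t (L : Coeffs n) → sumCoeffs (scaleCoeffs t L) ≡ t * sumCoeffs L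
sumCoeffs-scale t [] = sym (*-zeroʳ t)
sumCoeffs-scale t ((c , _) ∷ L) = trans (cong (t * c +_) (sumCoeffs-scale t L)) (sym (*-distribˡ-+ t c (sumCoeffs L)))

sumCoeffs-precompose : ∀ {n} τ (L : Coeffs n) → sumCoeffs (precomposeCoeffs τ L) ≡ sumCoeffs L
sumCoeffs-precompose τ [] = refl
sumCoeffs-precompose τ ((c , _) ∷ L) = cong (c +_) (sumCoeffs-precompose τ L)

scale-nonNeg : ∀ {n} {t} (L : Coeffs n) → 0ℚ ≤ t → NonNegCoeffs L → NonNegCoeffs (scaleCoeffs t L)
scale-nonNeg [] 0≤t [] = []
scale-nonNeg (_ ∷ L) 0≤t (0≤c ∷ nn) = 0≤* 0≤t 0≤c ∷ scale-nonNeg L 0≤t nn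

module _ {n} (λ' : Pt n) where

  combo-++ : ∀ (L M : Coeffs n) k → combo (L ++ M) λ' k ≡ combo L λ' k + combo M λ' k
  combo-++ [] M k = sym (+-identityˡ (combo M λ' k))
  combo-++ ((c , σ) ∷ L) M k =
    trans (cong (c * act σ λ' k +_) (combo-++ L M k)) (sym (+-assoc (c * act σ λ' k) (combo L λ' k) (combo M λ' k)))

  combo-scale : ∀ t (L : Coeffs n) k → combo (scaleCoeffs t L) λ' k ≡ t * combo L λ' k
  combo-scale t [] k = sym (*-zeroʳ t)
  combo-scale t ((c , σ) ∷ L) k =
    trans (cong₂ _+_ (*-assoc t c (act σ λ' k)) (combo-scale t L k)) (sym (*-distribˡ-+ t _ _))

  combo-precompose : ∀ τ (L : Coeffs n) k → combo (precomposeCoeffs τ L) λ' k ≡ combo L λ' (τ ⟨$⟩ʳ k)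
  combo-precompose τ [] k = refl
  combo-precompose τ ((c , σ) ∷ L) k = cong (c * act σ λ' (τ ⟨$⟩ʳ k) +_) (combo-precompose τ L k)

  Σᶠ-combo : InE λ' → ∀ (L : Coeffs n) → Σᶠ (combo L λ') ≡ 0ℚ
  Σᶠ-combo λ∈E [] = Σᶠ-zero {suc n}
  Σᶠ-combo λ∈E ((c , σ) ∷ L) = begin
    Σᶠ (λ k → c * act σ λ' k + combo L λ' k)          ≡⟨ Σᶠ-distrib-+ (λ k → c * act σ λ' k) (combo L λ') ⟩
    Σᶠ (λ k → c * act σ λ' k) + Σᶠ (combo L λ')       ≡⟨ cong₂ _+_ (Σᶠ-distribˡ-* c (act σ λ')) (Σᶠ-combo λ∈E L) ⟩
    c * Σᶠ (act σ λ') + 0ℚ                            ≡⟨ cong (λ x → c * x + 0ℚ) (trans (Σᶠ-permute λ' σ) λ∈E) ⟩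
    c * 0ℚ + 0ℚ                                       ≡⟨ cong (_+ 0ℚ) (*-zeroʳ c) ⟩
    0ℚ                                                ∎
    where open ≡-Reasoning

  Represents : Pt n → Coeffs n → Set
  Represents p L = NonNegCoeffs L × sumCoeffs L ≡ 1ℚ × p ≋ combo L λ'

  InP-cong : ∀ {p q} → p ≋ q → InP λ' p → InP λ' q
  InP-cong p≋q (L , nn , sum≡1 , p≋L) = L , nn , sum≡1 , λ k → trans (sym (p≋q k)) (p≋L k)

  InP⇒InE : InE λ' → ∀ {p} → InP λ' p → InE p
  InP⇒InE λ∈E (L , _ , _ , p≋L) = trans (Σᶠ-cong p≋L) (Σᶠ-combo λ∈E L)

  InP-orbit : ∀ σ → InP λ' (act σ λ')
  InP-orbit σ = (1ℚ , σ) ∷ [] , nonNegative⁻¹ 1ℚ ∷ [] , refl , λ k → sym (trans (+-identityʳ _) (*-identityˡ (act σ λ' k)))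

  InP-permute : ∀ τ {p} → InP λ' p → InP λ' (λ k → p (τ ⟨$⟩ʳ k))
  InP-permute τ (L , nn , sum≡1 , p≋L) =
    precomposeCoeffs τ L , AllP.map⁺ nn , trans (sumCoeffs-precompose τ L) sum≡1 ,
    λ k → trans (p≋L (τ ⟨$⟩ʳ k)) (sym (combo-precompose τ L k))

  InP-along : ∀ {x y t} → 0ℚ ≤ t → t ≤ 1ℚ → InP λ' x → InP λ' y → InP λ' (along x t y)
  InP-along {x} {y} {t} 0≤t t≤1 (L , nnL , sumL , x≋L) (M , nnM , sumM , y≋M) =
    scaleCoeffs (1ℚ - t) L ++ scaleCoeffs t M ,
    AllP.++⁺ (scale-nonNeg L (p≤q⇒0≤q-p t≤1) nnL) (scale-nonNeg M 0≤t nnM) ,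
    sum≡1 , along≋combo
    where
    open ≡-Reasoning
    affine : ∀ t a b → a + t * (b - a) ≡ (1ℚ - t) * a + t * b
    affine = solve 3 (λ t a b → a :+ t :* (b :- a) := (con 1ℚ :- t) :* a :+ t :* b) refl
    unit-partition : ∀ t → (1ℚ - t) * 1ℚ + t * 1ℚ ≡ 1ℚ
    unit-partition = solve 1 (λ t → (con 1ℚ :- t) :* con 1ℚ :+ t :* con 1ℚ := con 1ℚ) refl
    sum≡1 : sumCoeffs (scaleCoeffs (1ℚ - t) L ++ scaleCoeffs t M) ≡ 1ℚ
    sum≡1 = begin
      sumCoeffs (scaleCoeffs (1ℚ - t) L ++ scaleCoeffs t M)              ≡⟨ sumCoeffs-++ (scaleCoeffs (1ℚ - t) L) _ ⟩
      sumCoeffs (scaleCoeffs (1ℚ - t) L) + sumCoeffs (scaleCoeffs t M)   ≡⟨ cong₂ _+_ (sumCoeffs-scale (1ℚ - t) L) (sumCoeffs-scale t M) ⟩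
      (1ℚ - t) * sumCoeffs L + t * sumCoeffs M                           ≡⟨ cong₂ (λ a b → (1ℚ - t) * a + t * b) sumL sumM ⟩
      (1ℚ - t) * 1ℚ + t * 1ℚ                                             ≡⟨ unit-partition t ⟩
      1ℚ                                                                 ∎
    along≋combo : along x t y ≋ combo (scaleCoeffs (1ℚ - t) L ++ scaleCoeffs t M) λ'
    along≋combo k = begin
      x k + t * (y k - x k)                                              ≡⟨ affine t (x k) (y k) ⟩
      (1ℚ - t) * x k + t * y k                                           ≡⟨ cong₂ (λ a b → (1ℚ - t) * a + t * b) (x≋L k) (y≋M k) ⟩
      (1ℚ - t) * combo L λ' k + t * combo M λ' k                         ≡⟨ cong₂ _+_ (combo-scale (1ℚ - t) L k) (combo-scale t M k) ⟨
      combo (scaleCoeffs (1ℚ - t) L) λ' k + combo (scaleCoeffs t M) λ' k ≡⟨ combo-++ (scaleCoeffs (1ℚ - t) L) _ k ⟨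
      combo (scaleCoeffs (1ℚ - t) L ++ scaleCoeffs t M) λ' k             ∎

  combo-zero-head : ∀ σ (L : Coeffs n) k → combo ((0ℚ , σ) ∷ L) λ' k ≡ combo L λ' k
  combo-zero-head σ L k = trans (cong (_+ combo L λ' k) (*-zeroˡ (act σ λ' k))) (+-identityˡ (combo L λ' k))

  positive-head : ∀ {p} L → Represents p L → ∃₂ λ c σ → 0ℚ < c × ∃ λ M → Represents p ((c , σ) ∷ M)
  positive-head [] (_ , 0≡1 , _) = contradiction (sym 0≡1) 1≢0
  positive-head ((c , σ) ∷ L) rep@(0≤c ∷ nn , sum≡1 , p≋) with 0ℚ <? c
  ... | yes 0<c = c , σ , 0<c , L , rep
  ... | no c≯0 with ≤-antisym (≮⇒≥ c≯0) 0≤c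
  ...   | refl with positive-head L (nn , trans (sym (+-identityˡ _)) sum≡1 , λ k → trans (p≋ k) (combo-zero-head σ L k))
  ...     | c′ , σ′ , 0<c′ , M , (0≤c′ ∷ nnM , sum′≡1 , p≋′) =
    c′ , σ′ , 0<c′ , (0ℚ , σ) ∷ M ,
    (0≤c′ ∷ 0≤c ∷ nnM , trans (cong (c′ +_) (+-identityˡ (sumCoeffs M))) sum′≡1 ,
     λ k → trans (p≋′ k) (cong (c′ * act σ′ λ' k +_) (sym (combo-zero-head σ M k))))

  InP-extrapolate : ∀ {p} → InP λ' p →
    ∃₂ λ σ c → 0ℚ < c × (∀ ε → 0ℚ ≤ ε → ε ≤ c → InP λ' (along p (- ε) (act σ λ')))
  InP-extrapolate {p} (L , rep) with positive-head L rep
  ... | c , σ , 0<c , M , (0≤c ∷ nnM , sum≡1 , p≋) = σ , c , 0<c , extrapolated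
    where
    open ≡-Reasoning
    u = act σ λ'
    extrapolated : ∀ ε → 0ℚ ≤ ε → ε ≤ c → InP λ' (along p (- ε) u)
    extrapolated ε 0≤ε ε≤c =
      ((1ℚ + ε) * c - ε , σ) ∷ scaleCoeffs (1ℚ + ε) M ,
      head≥0 ∷ scale-nonNeg M (0≤+ (nonNegative⁻¹ 1ℚ) 0≤ε) nnM ,
      sum≡1′ , along≋combo
      where
      head-identity : ∀ c ε → (c - ε) + ε * c ≡ (1ℚ + ε) * c - ε
      head-identity = solve 2 (λ c ε → (c :- ε) :+ ε :* c := (con 1ℚ :+ ε) :* c :- ε) refl
      sum-identity : ∀ c ε s → (1ℚ + ε) * c - ε + (1ℚ + ε) * s ≡ (1ℚ + ε) * (c + s) - ε
      sum-identity = solve 3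
        (λ c ε s → (con 1ℚ :+ ε) :* c :- ε :+ (con 1ℚ :+ ε) :* s
                  := (con 1ℚ :+ ε) :* (c :+ s) :- ε) refl
      one-identity : ∀ ε → (1ℚ + ε) * 1ℚ - ε ≡ 1ℚ
      one-identity = solve 1 (λ ε → (con 1ℚ :+ ε) :* con 1ℚ :- ε := con 1ℚ) refl
      combo-identity : ∀ c ε a b → (c * a + b) + (- ε) * (a - (c * a + b)) ≡ ((1ℚ + ε) * c - ε) * a + (1ℚ + ε) * b
      combo-identity = solve 4
        (λ c ε a b → (c :* a :+ b) :+ (:- ε) :* (a :- (c :* a :+ b))
                    := ((con 1ℚ :+ ε) :* c :- ε) :* a :+ (con 1ℚ :+ ε) :* b) refl
      head≥0 : 0ℚ ≤ (1ℚ + ε) * c - ε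
      head≥0 = subst (0ℚ ≤_) (head-identity c ε) (0≤+ (p≤q⇒0≤q-p ε≤c) (0≤* 0≤ε (<⇒≤ 0<c)))
      sum≡1′ : (1ℚ + ε) * c - ε + sumCoeffs (scaleCoeffs (1ℚ + ε) M) ≡ 1ℚ
      sum≡1′ = begin
        (1ℚ + ε) * c - ε + sumCoeffs (scaleCoeffs (1ℚ + ε) M) ≡⟨ cong ((1ℚ + ε) * c - ε +_) (sumCoeffs-scale (1ℚ + ε) M) ⟩
        (1ℚ + ε) * c - ε + (1ℚ + ε) * sumCoeffs M           ≡⟨ sum-identity c ε (sumCoeffs M) ⟩
        (1ℚ + ε) * (c + sumCoeffs M) - ε                    ≡⟨ cong (λ s → (1ℚ + ε) * s - ε) sum≡1 ⟩
        (1ℚ + ε) * 1ℚ - ε                                   ≡⟨ one-identity ε ⟩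
        1ℚ                                                  ∎
      along≋combo : along p (- ε) u ≋ combo (((1ℚ + ε) * c - ε , σ) ∷ scaleCoeffs (1ℚ + ε) M) λ'
      along≋combo k = begin
        p k + (- ε) * (u k - p k)                                  ≡⟨ cong (λ x → x + (- ε) * (u k - x)) (p≋ k) ⟩
        (c * u k + combo M λ' k) + (- ε) * (u k - (c * u k + combo M λ' k)) ≡⟨ combo-identity c ε (u k) (combo M λ' k) ⟩
        ((1ℚ + ε) * c - ε) * u k + (1ℚ + ε) * combo M λ' k        ≡⟨ cong (((1ℚ + ε) * c - ε) * u k +_) (combo-scale (1ℚ + ε) M k) ⟨
        ((1ℚ + ε) * c - ε) * u k + combo (scaleCoeffs (1ℚ + ε) M) λ' k ∎

transpose-matchˡ : ∀ {m} (i j : Fin m) → transpose i j ⟨$⟩ʳ i ≡ j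
transpose-matchˡ i j rewrite dec-true (i ≟ᶠ i) refl = refl

transpose-matchʳ : ∀ {m} (i j : Fin m) → transpose i j ⟨$⟩ʳ j ≡ i
transpose-matchʳ i j with j ≟ᶠ i
... | yes refl = refl
... | no _ rewrite dec-true (j ≟ᶠ j) refl = refl

transpose-other : ∀ {m} {i j k : Fin m} → k ≢ i → k ≢ j → transpose i j ⟨$⟩ʳ k ≡ k
transpose-other {i = i} {j} {k} k≢i k≢j rewrite dec-false (k ≟ᶠ i) k≢i | dec-false (k ≟ᶠ j) k≢j = refl

transpose-preserves : ∀ {m} {A : Set} (f : Fin m → A) {i j} → f i ≡ f j → ∀ k → f (transpose i j ⟨$⟩ʳ k) ≡ f k
transpose-preserves f {i} {j} fi≡fj k = by-cases (k ≟ᶠ i) (k ≟ᶠ j)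
  where
  by-cases : Dec (k ≡ i) → Dec (k ≡ j) → f (transpose i j ⟨$⟩ʳ k) ≡ f k
  by-cases (yes refl) _ = trans (cong f (transpose-matchˡ i j)) (sym fi≡fj)
  by-cases (no _) (yes refl) = trans (cong f (transpose-matchʳ i j)) fi≡fj
  by-cases (no k≢i) (no k≢j) = cong f (transpose-other k≢i k≢j)

record Move (n : ℕ) : Set where
  constructor move
  field
    i j : Fin (suc n)
    weight : ℚ

average : ∀ {n} → Move n → Pt n → Pt n
average (move i j t) z = along z t (λ k → z (transpose i j ⟨$⟩ʳ k))

module _ {n} (z : Pt n) (i j : Fin (suc n)) (t : ℚ) where

  average-matchˡ : average (move i j t) z i ≡ z i + t * (z j - z i)
  average-matchˡ = cong (λ k → z i + t * (z k - z i)) (transpose-matchˡ i j)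

  average-matchʳ : average (move i j t) z j ≡ z j + t * (z i - z j)
  average-matchʳ = cong (λ k → z j + t * (z k - z j)) (transpose-matchʳ i j)

  average-other : ∀ {k} → k ≢ i → k ≢ j → average (move i j t) z k ≡ z k
  average-other {k} k≢i k≢j = trans (cong (λ l → z k + t * (z l - z k)) (transpose-other k≢i k≢j)) (along-refl z t k)

average-cong : ∀ {n} (m : Move n) {x y} → x ≋ y → average m x ≋ average m y
average-cong (move i j t) x≋y = along-cong t x≋y (λ k → x≋y (transpose i j ⟨$⟩ʳ k))

Fixes : ∀ {n} → Move n → Pt n → Set
Fixes m v = v (Move.i m) ≡ v (Move.j m)

average-fixes : ∀ {n} {v : Pt n} (m : Move n) → Fixes m v → ∀ {z} → z ≋ v → average m z ≋ v
average-fixes {v = v} (move i j t) vi≡vj {z} z≋v k = begin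
  average (move i j t) z k                   ≡⟨ average-cong (move i j t) z≋v k ⟩
  v k + t * (v (transpose i j ⟨$⟩ʳ k) - v k) ≡⟨ cong (λ x → v k + t * (x - v k)) (transpose-preserves v vi≡vj k) ⟩
  v k + t * (v k - v k)                      ≡⟨ along-refl v t k ⟩
  v k                                        ∎
  where open ≡-Reasoning

average-along : ∀ {n} (m : Move n) x s y → average m (along x s y) ≋ along (average m x) s (average m y)
average-along (move i j t) x s y k = bilinear t s (x k) (y k) (x (transpose i j ⟨$⟩ʳ k)) (y (transpose i j ⟨$⟩ʳ k))
  where
  bilinear : ∀ t s a b a′ b′ →
    (a + s * (b - a)) + t * ((a′ + s * (b′ - a′)) - (a + s * (b - a))) ≡
    (a + t * (a′ - a)) + s * ((b + t * (b′ - b)) - (a + t * (a′ - a)))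
  bilinear = solve 6
    (λ t s a b a′ b′ → (a :+ s :* (b :- a)) :+ t :* ((a′ :+ s :* (b′ :- a′)) :- (a :+ s :* (b :- a)))
                      := (a :+ t :* (a′ :- a)) :+ s :* ((b :+ t :* (b′ :- b)) :- (a :+ t :* (a′ :- a)))) refl

average-InP : ∀ {n} (λ' : Pt n) (m : Move n) → 0ℚ ≤ Move.weight m → Move.weight m ≤ 1ℚ →
  ∀ {z} → InP λ' z → InP λ' (average m z)
average-InP λ' (move i j t) 0≤t t≤1 z∈P = InP-along λ' 0≤t t≤1 z∈P (InP-permute λ' (transpose i j) z∈P)

average-InZInv : ∀ {n} N (m : Move n) → InZInv N (Move.weight m) →
  ∀ {z} → (∀ k → InZInv N (z k)) → ∀ k → InZInv N (average m z k)
average-InZInv N (move i j t) ht {z} hz k =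
  InZInv-along N (z k) t (z (transpose i j ⟨$⟩ʳ k)) (hz k) ht (hz (transpose i j ⟨$⟩ʳ k))

averages : ∀ {n} → List (Move n) → Pt n → Pt n
averages [] z = z
averages (m ∷ ms) z = averages ms (average m z)

averages-++ : ∀ {n} (ms ms′ : List (Move n)) z → averages (ms ++ ms′) z ≡ averages ms′ (averages ms z)
averages-++ [] ms′ z = refl
averages-++ (m ∷ ms) ms′ z = averages-++ ms ms′ (average m z)

averages-preserves : ∀ {n} {P : Pt n → Set} (ms : List (Move n)) →
  All (λ m → ∀ {z} → P z → P (average m z)) ms → ∀ {z} → P z → P (averages ms z)
averages-preserves [] [] Pz = Pz
averages-preserves (m ∷ ms) (pres ∷ preserved) Pz = averages-preserves ms preserved (pres Pz)

averages-cong : ∀ {n} (ms : List (Move n)) {x y} → x ≋ y → averages ms x ≋ averages ms y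
averages-cong [] x≋y = x≋y
averages-cong (m ∷ ms) x≋y = averages-cong ms (average-cong m x≋y)

averages-along : ∀ {n} (ms : List (Move n)) x s y → averages ms (along x s y) ≋ along (averages ms x) s (averages ms y)
averages-along [] x s y k = refl
averages-along (m ∷ ms) x s y k =
  trans (averages-cong ms (average-along m x s y) k) (averages-along ms (average m x) s (average m y) k)

-- Averaging over the level sets of a point

Reciprocal≤ : ℕ → ℚ → Set
Reciprocal≤ N t = ∃ λ d → suc d ℕ.≤ N × t ≡ ℤ.+ 1 / suc d

Reciprocal≤-mono : ∀ {M N t} → M ℕ.≤ N → Reciprocal≤ M t → Reciprocal≤ N t
Reciprocal≤-mono M≤N (d , d<M , t≡) = d , ℕ.≤-trans d<M M≤N , t≡

Reciprocal≤⇒0≤ : ∀ {N t} → Reciprocal≤ N t → 0ℚ ≤ t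
Reciprocal≤⇒0≤ (d , _ , refl) = nonNegative⁻¹ _ {{normalize-nonNeg 1 (suc d)}}

Reciprocal≤⇒≤1 : ∀ {N t} → Reciprocal≤ N t → t ≤ 1ℚ
Reciprocal≤⇒≤1 (d , _ , refl) =
  0≤q-p⇒p≤q (subst (0ℚ ≤_) (sym 1-t≡d*t) (0≤* (nonNegative⁻¹ (ℕ→ℚ d) {{normalize-nonNeg d 1}}) (Reciprocal≤⇒0≤ (d , ℕ.≤-refl , refl))))
  where
  t = ℤ.+ 1 / suc d
  identity : ∀ D t → 1ℚ - t ≡ D * t + ((D + 1ℚ) * t - 1ℚ) * (- 1ℚ)
  identity = solve 2 (λ D t → con 1ℚ :- t := D :* t :+ ((D :+ con 1ℚ) :* t :- con 1ℚ) :* (:- con 1ℚ)) refl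
  1-t≡d*t : 1ℚ - t ≡ ℕ→ℚ d * t
  1-t≡d*t = ≡-via-unit _ _ _ (trans (cong (_* t) (sym (ℕ→ℚ-suc d))) (ℕ→ℚ-*-1/ d)) (identity (ℕ→ℚ d) t)

Reciprocal≤⇒InZInv : ∀ {N t} → Reciprocal≤ N t → InZInv (N !) t
Reciprocal≤⇒InZInv {N} (d , d<N , refl) = InZInv-1/ (N !) d (∣-trans (m∣m*n (d !)) (m≤n⇒m!∣n! d<N))

-- merge k bs averages k into bs, on which w is constant m. The move for b, with r elements of bs
-- after it, has weight 1/(r + 2): it gives b the final common value A and keeps w k = A + r (A - m).
merge-step : ∀ {t r A m} → t * (r + 1ℚ + 1ℚ) ≡ 1ℚ →
  m + t * ((A + (r + 1ℚ) * (A - m)) - m) ≡ A ×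
  (A + (r + 1ℚ) * (A - m)) + t * (m - (A + (r + 1ℚ) * (A - m))) ≡ A + r * (A - m)
merge-step {t} {r} {A} {m} t*[r+2]≡1 =
  ≡-via-unit _ A (A - m) t*[r+2]≡1 (first t r A m) ,
  ≡-via-unit _ (A + r * (A - m)) (m - A) t*[r+2]≡1 (second t r A m)
  where
  first : ∀ t r A m → m + t * ((A + (r + 1ℚ) * (A - m)) - m) ≡ A + (t * (r + 1ℚ + 1ℚ) - 1ℚ) * (A - m)
  first = solve 4
    (λ t r A m → m :+ t :* ((A :+ (r :+ con 1ℚ) :* (A :- m)) :- m)
                := A :+ (t :* (r :+ con 1ℚ :+ con 1ℚ) :- con 1ℚ) :* (A :- m)) refl
  second : ∀ t r A m →
    (A + (r + 1ℚ) * (A - m)) + t * (m - (A + (r + 1ℚ) * (A - m))) ≡ (A + r * (A - m)) + (t * (r + 1ℚ + 1ℚ) - 1ℚ) * (m - A)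
  second = solve 4
    (λ t r A m → (A :+ (r :+ con 1ℚ) :* (A :- m)) :+ t :* (m :- (A :+ (r :+ con 1ℚ) :* (A :- m)))
                := (A :+ r :* (A :- m)) :+ (t :* (r :+ con 1ℚ :+ con 1ℚ) :- con 1ℚ) :* (m :- A)) refl

merge : ∀ {n} → Fin (suc n) → List (Fin (suc n)) → List (Move n)
merge k [] = []
merge k (b ∷ bs) = move b k (ℤ.+ 1 / suc (suc (length bs))) ∷ merge k bs

merge-outside : ∀ {n} k bs {w : Pt n} {p} → p ≢ k → p ∉ bs → averages (merge k bs) w p ≡ w p
merge-outside k [] p≢k p∉bs = refl
merge-outside k (b ∷ bs) {w} p≢k p∉b∷bs =
  trans (merge-outside k bs p≢k (p∉b∷bs ∘ there)) (average-other w b k (ℤ.+ 1 / suc (suc (length bs))) (p∉b∷bs ∘ here) p≢k)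

merge-inside : ∀ {n} k bs → Unique bs → k ∉ bs → ∀ {w : Pt n} {m A} →
  (∀ {b} → b ∈ bs → w b ≡ m) → w k ≡ A + ℕ→ℚ (length bs) * (A - m) →
  ∀ {p} → p ∈ k ∷ bs → averages (merge k bs) w p ≡ A
merge-inside k [] _ _ {w} {m} {A} _ wk≡ (here refl) = trans wk≡ (vanish A m)
  where
  vanish : ∀ A m → A + 0ℚ * (A - m) ≡ A
  vanish = solve 2 (λ A m → A :+ con 0ℚ :* (A :- m) := A) refl
merge-inside k (b ∷ bs) uniq k∉b∷bs {w} {m} {A} w≡m wk≡ = inside
  where
  t = ℤ.+ 1 / suc (suc (length bs))
  R = ℕ→ℚ (length bs)
  w′ = average (move b k t) w
  b∉bs = Unique[x∷xs]⇒x∉xs uniq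
  b≢k : b ≢ k
  b≢k b≡k = k∉b∷bs (here (sym b≡k))
  t*[R+2]≡1 : t * (R + 1ℚ + 1ℚ) ≡ 1ℚ
  t*[R+2]≡1 = trans (cong (t *_) (sym (trans (ℕ→ℚ-suc (suc (length bs))) (cong (_+ 1ℚ) (ℕ→ℚ-suc (length bs))))))
                    (trans (*-comm t _) (ℕ→ℚ-*-1/ (suc (length bs))))
  wk≡′ : w k ≡ A + (R + 1ℚ) * (A - m)
  wk≡′ = trans wk≡ (cong (λ x → A + x * (A - m)) (ℕ→ℚ-suc (length bs)))
  w′b≡A : w′ b ≡ A
  w′b≡A = trans (average-matchˡ w b k t)
    (trans (cong₂ (λ x y → x + t * (y - x)) (w≡m (here refl)) wk≡′)
      (proj₁ (merge-step {t} {R} {A} {m} t*[R+2]≡1)))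
  w′k≡ : w′ k ≡ A + R * (A - m)
  w′k≡ = trans (average-matchʳ w b k t)
    (trans (cong₂ (λ x y → x + t * (y - x)) wk≡′ (w≡m (here refl)))
      (proj₂ (merge-step {t} {R} {A} {m} t*[R+2]≡1)))
  w′≡m : ∀ {b′} → b′ ∈ bs → w′ b′ ≡ m
  w′≡m b′∈bs = trans (average-other w b k t (λ b′≡b → b∉bs (subst (_∈ bs) b′≡b b′∈bs)) (λ b′≡k → k∉b∷bs (there (subst (_∈ bs) b′≡k b′∈bs))))
                     (w≡m (there b′∈bs))
  rest : ∀ {p} → p ∈ k ∷ bs → averages (merge k bs) w′ p ≡ A
  rest = merge-inside k bs (Unique-tail uniq) (k∉b∷bs ∘ there) w′≡m w′k≡
  inside : ∀ {p} → p ∈ k ∷ b ∷ bs → averages (merge k (b ∷ bs)) w p ≡ A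
  inside (here refl) = rest (here refl)
  inside (there (here refl)) = trans (merge-outside k bs b≢k b∉bs) w′b≡A
  inside (there (there p∈bs)) = rest (there p∈bs)

merge-constant : ∀ {n} k bs → Unique bs → k ∉ bs → ∀ {w : Pt n} →
  (∀ {b b′} → b ∈ bs → b′ ∈ bs → w b ≡ w b′) → ∃ λ A → ∀ {p} → p ∈ k ∷ bs → averages (merge k bs) w p ≡ A
merge-constant k [] _ _ {w} _ = w k , λ { (here refl) → refl }
merge-constant k (b ∷ bs) uniq k∉ {w} constant =
  A , merge-inside k (b ∷ bs) uniq k∉ (λ b′∈ → constant b′∈ (here refl)) wk≡
  where
  r = suc (length bs)
  u = ℤ.+ 1 / suc r
  A = (w k + ℕ→ℚ r * w b) * u
  identity : ∀ W R m u → W ≡ ((W + R * m) * u + R * ((W + R * m) * u - m)) + ((R + 1ℚ) * u - 1ℚ) * (- (W + R * m))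
  identity = solve 4
    (λ W R m u → W
                := ((W :+ R :* m) :* u :+ R :* ((W :+ R :* m) :* u :- m)) :+ ((R :+ con 1ℚ) :* u :- con 1ℚ) :* (:- (W :+ R :* m))) refl
  wk≡ : w k ≡ A + ℕ→ℚ r * (A - w b)
  wk≡ = ≡-via-unit _ _ _ (trans (cong (_* u) (sym (ℕ→ℚ-suc r))) (ℕ→ℚ-*-1/ r)) (identity (w k) (ℕ→ℚ r) (w b) u)

merge-weights : ∀ {n} k (bs : List (Fin (suc n))) → All (Reciprocal≤ (suc (length bs)) ∘ Move.weight) (merge k bs)
merge-weights k [] = []
merge-weights k (b ∷ bs) = (suc (length bs) , ℕ.≤-refl , refl) ∷ All.map (Reciprocal≤-mono (ℕ.n≤1+n _)) (merge-weights k bs)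

merge-fixes : ∀ {n} (v : Pt n) k bs → All (λ b → v b ≡ v k) bs → All (λ m → Fixes m v) (merge k bs)
merge-fixes v k [] [] = []
merge-fixes v k (b ∷ bs) (vb≡vk ∷ level) = vb≡vk ∷ merge-fixes v k bs level

module _ {n} (v : Pt n) where

  sameLevel : Fin (suc n) → List (Fin (suc n)) → List (Fin (suc n))
  sameLevel k = filter (λ p → v p ≟ v k)

  symmetrisingMoves : List (Fin (suc n)) → List (Move n)
  symmetrisingMoves [] = []
  symmetrisingMoves (k ∷ ks) = symmetrisingMoves ks ++ merge k (sameLevel k ks)

  Equalises : List (Fin (suc n)) → Pt n → Set
  Equalises ks w = ∀ {p q} → p ∈ ks → q ∈ ks → v p ≡ v q → w p ≡ w q

  symmetrisingMoves-equalises : ∀ {ks} → Unique ks → ∀ z → Equalises ks (averages (symmetrisingMoves ks) z)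
  symmetrisingMoves-equalises {[]} _ z ()
  symmetrisingMoves-equalises {k ∷ ks} uniq z {p} {q} p∈ q∈ vp≡vq =
    trans (cong-app (averages-++ (symmetrisingMoves ks) (merge k B) z) p)
      (trans merged (sym (cong-app (averages-++ (symmetrisingMoves ks) (merge k B) z) q)))
    where
    w = averages (symmetrisingMoves ks) z
    B = sameLevel k ks
    equalised = symmetrisingMoves-equalises (Unique-tail uniq) z
    level : ∀ {b} → b ∈ B → v b ≡ v k
    level b∈B = proj₂ (∈-filter⁻ (λ p → v p ≟ v k) {xs = ks} b∈B)
    B⊆ks : ∀ {b} → b ∈ B → b ∈ ks
    B⊆ks b∈B = proj₁ (∈-filter⁻ (λ p → v p ≟ v k) {xs = ks} b∈B)
    k∉B : k ∉ B
    k∉B = Unique[x∷xs]⇒x∉xs uniq ∘ B⊆ks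
    A,merged = merge-constant k B (filter⁺ (λ p → v p ≟ v k) (Unique-tail uniq)) k∉B
                 (λ b∈B b′∈B → equalised (B⊆ks b∈B) (B⊆ks b′∈B) (trans (level b∈B) (sym (level b′∈B))))
    onLevel : ∀ {p} → p ∈ k ∷ ks → v p ≡ v k → p ∈ k ∷ B
    onLevel (here refl) _ = here refl
    onLevel (there p∈ks) vp≡vk = there (∈-filter⁺ (λ p → v p ≟ v k) p∈ks vp≡vk)
    offLevel : ∀ {p} → p ∈ k ∷ ks → v p ≢ v k → p ∈ ks × averages (merge k B) w p ≡ w p
    offLevel (here refl) vk≢vk = contradiction refl vk≢vk
    offLevel {p} (there p∈ks) vp≢vk = p∈ks , merge-outside k B (λ p≡k → vp≢vk (cong v p≡k)) (vp≢vk ∘ level)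
    merged : averages (merge k B) w p ≡ averages (merge k B) w q
    merged with v p ≟ v k
    ... | yes vp≡vk = trans (proj₂ A,merged (onLevel p∈ vp≡vk)) (sym (proj₂ A,merged (onLevel q∈ (trans (sym vp≡vq) vp≡vk))))
    ... | no vp≢vk with offLevel p∈ vp≢vk | offLevel q∈ (λ vq≡vk → vp≢vk (trans vp≡vq vq≡vk))
    ...   | p∈ks , p-unchanged | q∈ks , q-unchanged = trans p-unchanged (trans (equalised p∈ks q∈ks vp≡vq) (sym q-unchanged))

  symmetrisingMoves-weights : ∀ ks → All (Reciprocal≤ (length ks) ∘ Move.weight) (symmetrisingMoves ks)
  symmetrisingMoves-weights [] = []
  symmetrisingMoves-weights (k ∷ ks) = AllP.++⁺
    (All.map (Reciprocal≤-mono (ℕ.n≤1+n _)) (symmetrisingMoves-weights ks))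
    (All.map (Reciprocal≤-mono (ℕ.s≤s (length-filter (λ p → v p ≟ v k) ks))) (merge-weights k (sameLevel k ks)))

  symmetrisingMoves-fix : ∀ ks → All (λ m → Fixes m v) (symmetrisingMoves ks)
  symmetrisingMoves-fix [] = []
  symmetrisingMoves-fix (k ∷ ks) =
    AllP.++⁺ (symmetrisingMoves-fix ks) (merge-fixes v k (sameLevel k ks) (AllP.all-filter (λ p → v p ≟ v k) ks))

symmetrise : ∀ {n} → Pt n → Pt n → Pt n
symmetrise {n} v = averages (symmetrisingMoves v (allFin (suc n)))

module _ {n} (v : Pt n) where

  private
    moves = symmetrisingMoves v (allFin (suc n))

    weights : All (Reciprocal≤ (suc n) ∘ Move.weight) moves
    weights = subst (λ N → All (Reciprocal≤ N ∘ Move.weight) moves) (length-tabulate id) (symmetrisingMoves-weights v (allFin (suc n)))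

  symmetrise-equalises : ∀ z {p q} → v p ≡ v q → symmetrise v z p ≡ symmetrise v z q
  symmetrise-equalises z = symmetrisingMoves-equalises v (allFin⁺ (suc n)) z (∈-allFin _) (∈-allFin _)

  symmetrise-fixes : symmetrise v v ≋ v
  symmetrise-fixes = averages-preserves {P = _≋ v} moves
    (All.map (λ {m} vi≡vj {z} → average-fixes m vi≡vj {z}) (symmetrisingMoves-fix v (allFin (suc n)))) (λ _ → refl)

  symmetrise-along : ∀ x s y → symmetrise v (along x s y) ≋ along (symmetrise v x) s (symmetrise v y)
  symmetrise-along = averages-along moves

  symmetrise-InP : ∀ (λ' : Pt n) {z} → InP λ' z → InP λ' (symmetrise v z)
  symmetrise-InP λ' = averages-preserves {P = InP λ'} moves (All.map (λ {m} r {z} → average-InP λ' m (Reciprocal≤⇒0≤ r) (Reciprocal≤⇒≤1 r) {z}) weights)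

  symmetrise-InZInv : ∀ {z} → (∀ k → InZInv ((suc n) !) (z k)) → ∀ k → InZInv ((suc n) !) (symmetrise v z k)
  symmetrise-InZInv = averages-preserves {P = λ z → ∀ k → InZInv ((suc n) !) (z k)} moves
    (All.map (λ {m} r {z} → average-InZInv ((suc n) !) m (Reciprocal≤⇒InZInv r) {z}) weights)

-- Coordinates of dominant weights

integral-offsets : ∀ {n} (x : Pt n) → (∀ i → ∃ λ (z : ℤ) → ⟨ x ,α i ⟩ ≡ ℤ→ℚ z) → ∀ p → ∃ λ z → x p ≡ x fzero + ℤ→ℚ z
integral-offsets x integral fzero = ℤ.+ 0 , sym (+-identityʳ (x fzero))
integral-offsets {suc n} x integral (fsuc p) with integral-offsets (x ∘ fsuc) (integral ∘ fsuc) p | integral fzero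
... | z , xp≡ | z₀ , x₀-x₁≡ = z ℤ.- z₀ , (begin
  x (fsuc p)                                 ≡⟨ xp≡ ⟩
  x (fsuc fzero) + ℤ→ℚ z                     ≡⟨ shift (x fzero) (x (fsuc fzero)) (ℤ→ℚ z) ⟩
  x fzero + (ℤ→ℚ z - (x fzero - x (fsuc fzero))) ≡⟨ cong (λ d → x fzero + (ℤ→ℚ z - d)) x₀-x₁≡ ⟩
  x fzero + (ℤ→ℚ z - ℤ→ℚ z₀)                ≡⟨ cong (x fzero +_) (trans (cong (ℤ→ℚ z +_) (sym (ℤ→ℚ-homo-neg z₀))) (sym (ℤ→ℚ-homo-+ z (ℤ.- z₀)))) ⟩
  x fzero + ℤ→ℚ (z ℤ.- z₀)                  ∎)
  where
  open ≡-Reasoning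
  shift : ∀ a b c → b + c ≡ a + (c - (a - b))
  shift = solve 3 (λ a b c → b :+ c := a :+ (c :- (a :- b))) refl

dominant-InZInv : ∀ {n} N → suc n ∣ N → {λ' : Pt n} → DominantWeight λ' → ∀ p → InZInv N (λ' p)
dominant-InZInv {n} N n+1∣N {λ'} (λ∈E , dominant) p =
  subst (InZInv N) (sym (proj₂ (offset p))) (InZInv-+ N {λ' fzero} λ₀∈ (InZInv-ℤ N (proj₁ (offset p))))
  where
  open ≡-Reasoning
  offset = integral-offsets λ' (λ i → ℤ.+ proj₁ (dominant i) , proj₂ (dominant i))
  z : Fin (suc n) → ℚ
  z k = ℤ→ℚ (proj₁ (offset k))
  u = ℤ.+ 1 / suc n
  [n+1]λ₀+Σz≡0 : ℕ→ℚ (suc n) * λ' fzero + Σᶠ z ≡ 0ℚ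
  [n+1]λ₀+Σz≡0 = begin
    ℕ→ℚ (suc n) * λ' fzero + Σᶠ z        ≡⟨ cong (_+ Σᶠ z) (Σᶠ-const {suc n} (λ' fzero)) ⟨
    Σᶠ {suc n} (λ _ → λ' fzero) + Σᶠ z     ≡⟨ Σᶠ-distrib-+ (λ _ → λ' fzero) z ⟨
    Σᶠ (λ k → λ' fzero + z k)              ≡⟨ Σᶠ-cong (λ k → sym (proj₂ (offset k))) ⟩
    Σᶠ λ'                                  ≡⟨ λ∈E ⟩
    0ℚ                                     ∎
  scale-back : ∀ M l u → l ≡ u * (M * l) + (M * u - 1ℚ) * (- l)
  scale-back = solve 3 (λ M l u → l := u :* (M :* l) :+ (M :* u :- con 1ℚ) :* (:- l)) refl
  isolate : ∀ a b → a ≡ - b + (a + b)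
  isolate = solve 2 (λ a b → a := :- b :+ (a :+ b)) refl
  λ₀≡ : λ' fzero ≡ u * (- Σᶠ z)
  λ₀≡ = begin
    λ' fzero                               ≡⟨ ≡-via-unit _ _ _ (ℕ→ℚ-*-1/ n) (scale-back (ℕ→ℚ (suc n)) (λ' fzero) u) ⟩
    u * (ℕ→ℚ (suc n) * λ' fzero)           ≡⟨ cong (u *_) (isolate (ℕ→ℚ (suc n) * λ' fzero) (Σᶠ z)) ⟩
    u * (- Σᶠ z + (ℕ→ℚ (suc n) * λ' fzero + Σᶠ z)) ≡⟨ cong (λ s → u * (- Σᶠ z + s)) [n+1]λ₀+Σz≡0 ⟩
    u * (- Σᶠ z + 0ℚ)                      ≡⟨ cong (u *_) (+-identityʳ (- Σᶠ z)) ⟩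
    u * (- Σᶠ z)                           ∎
  λ₀∈ : InZInv N (λ' fzero)
  λ₀∈ = subst (InZInv N) (sym λ₀≡) (InZInv-* N {u} (InZInv-1/ N n n+1∣N)
          (InZInv-neg N {Σᶠ z} (InZInv-Σᶠ N z (λ k → InZInv-ℤ N (proj₁ (offset k))))))

-- Small perturbations inside the chamber

ForSmall : (ℚ → Set) → Set
ForSmall P = ∃ λ δ → 0ℚ < δ × (∀ ε → 0ℚ ≤ ε → ε ≤ δ → P ε)

ForSmall-map : ∀ {P Q : ℚ → Set} → (∀ {ε} → 0ℚ ≤ ε → P ε → Q ε) → ForSmall P → ForSmall Q
ForSmall-map P⇒Q (δ , 0<δ , small) = δ , 0<δ , λ ε 0≤ε ε≤δ → P⇒Q 0≤ε (small ε 0≤ε ε≤δ)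

ForSmall-× : ∀ {P Q : ℚ → Set} → ForSmall P → ForSmall Q → ForSmall (λ ε → P ε × Q ε)
ForSmall-× (δ₁ , 0<δ₁ , small₁) (δ₂ , 0<δ₂ , small₂) = δ₁ ⊓ δ₂ , 0<δ₁⊓δ₂ ,
  λ ε 0≤ε ε≤δ → small₁ ε 0≤ε (≤-trans ε≤δ (p⊓q≤p δ₁ δ₂)) , small₂ ε 0≤ε (≤-trans ε≤δ (p⊓q≤q δ₁ δ₂))
  where
  0<δ₁⊓δ₂ : 0ℚ < δ₁ ⊓ δ₂
  0<δ₁⊓δ₂ with ⊓-sel δ₁ δ₂
  ... | inj₁ δ₁⊓δ₂≡δ₁ = subst (0ℚ <_) (sym δ₁⊓δ₂≡δ₁) 0<δ₁
  ... | inj₂ δ₁⊓δ₂≡δ₂ = subst (0ℚ <_) (sym δ₁⊓δ₂≡δ₂) 0<δ₂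

ForSmall-∀ : ∀ {m} {P : Fin m → ℚ → Set} → (∀ i → ForSmall (P i)) → ForSmall (λ ε → ∀ i → P i ε)
ForSmall-∀ {zero} _ = 1ℚ , positive⁻¹ 1ℚ , λ _ _ _ ()
ForSmall-∀ {suc m} small = ForSmall-map (λ _ (P₀ , Pₛ) → λ { fzero → P₀ ; (fsuc i) → Pₛ i })
  (ForSmall-× (small fzero) (ForSmall-∀ (small ∘ fsuc)))

ForSmall-≤ : ∀ {c} → 0ℚ < c → ForSmall (_≤ c)
ForSmall-≤ {c} 0<c = c , 0<c , λ _ _ ε≤c → ε≤c

ForSmall-ε∣h∣≤g : ∀ {g h} → 0ℚ ≤ g → (g ≡ 0ℚ → h ≡ 0ℚ) → ForSmall (λ ε → ε * ∣ h ∣ ≤ g)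
ForSmall-ε∣h∣≤g {g} {h} 0≤g g≡0⇒h≡0 with g ≟ 0ℚ
... | yes refl = 1ℚ , positive⁻¹ 1ℚ , λ ε _ _ → ≤-reflexive (trans (cong (λ x → ε * ∣ x ∣) (g≡0⇒h≡0 refl)) (*-zeroʳ ε))
... | no g≢0 = r , positive⁻¹ r {{pos*pos⇒pos g {{g>0}} w {{1/pos⇒pos (1ℚ + ∣ h ∣) {{1+∣h∣>0}}}}}} , bound
  where
  instance
    1+∣h∣>0 : Positive (1ℚ + ∣ h ∣)
    1+∣h∣>0 = pos+nonNeg⇒pos 1ℚ ∣ h ∣ {{∣-∣-nonNeg h}}
    1+∣h∣≢0 : NonZero (1ℚ + ∣ h ∣)
    1+∣h∣≢0 = pos⇒nonZero (1ℚ + ∣ h ∣)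
    g>0 : Positive g
    g>0 = nonNeg∧nonZero⇒pos g {{nonNegative 0≤g}} {{≢-nonZero g≢0}}
  w = 1/ (1ℚ + ∣ h ∣)
  r = g * w
  r*[1+∣h∣]≡g : r * (1ℚ + ∣ h ∣) ≡ g
  r*[1+∣h∣]≡g = trans (*-assoc g w _) (trans (cong (g *_) (*-inverseˡ (1ℚ + ∣ h ∣))) (*-identityʳ g))
  ∣h∣≤1+∣h∣ : ∣ h ∣ ≤ 1ℚ + ∣ h ∣
  ∣h∣≤1+∣h∣ = subst (_≤ 1ℚ + ∣ h ∣) (+-identityˡ ∣ h ∣) (+-monoˡ-≤ ∣ h ∣ (nonNegative⁻¹ 1ℚ))
  bound : ∀ ε → 0ℚ ≤ ε → ε ≤ r → ε * ∣ h ∣ ≤ g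
  bound ε 0≤ε ε≤r = begin
    ε * ∣ h ∣             ≤⟨ *-monoʳ-≤-nonNeg ∣ h ∣ {{∣-∣-nonNeg h}} ε≤r ⟩
    r * ∣ h ∣             ≤⟨ *-monoˡ-≤-nonNeg r {{nonNegative (≤-trans 0≤ε ε≤r)}} ∣h∣≤1+∣h∣ ⟩
    r * (1ℚ + ∣ h ∣)      ≡⟨ r*[1+∣h∣]≡g ⟩
    g                     ∎
    where open ≤-Reasoning

chamber-perturbation : ∀ {n} (v y : Pt n) → (∀ i → 0ℚ ≤ ⟨ v ,α i ⟩) → (∀ i → ⟨ v ,α i ⟩ ≡ 0ℚ → ⟨ y ,α i ⟩ ≡ 0ℚ) →
  ForSmall (λ ε → ∀ i → 0ℚ ≤ ⟨ along v ε y ,α i ⟩ × 0ℚ ≤ ⟨ along v (- ε) y ,α i ⟩)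
chamber-perturbation v y v∈C ties = ForSmall-map both-directions (ForSmall-∀ λ i → ForSmall-ε∣h∣≤g (v∈C i) (h≡0 i))
  where
  h : _ → ℚ
  h i = ⟨ y ,α i ⟩ - ⟨ v ,α i ⟩
  h≡0 : ∀ i → ⟨ v ,α i ⟩ ≡ 0ℚ → h i ≡ 0ℚ
  h≡0 i g≡0 = trans (cong₂ _-_ (ties i g≡0) g≡0) (+-inverseʳ 0ℚ)
  pairing : ∀ t a b c d → (a + t * (c - a)) - (b + t * (d - b)) ≡ (a - b) + t * ((c - d) - (a - b))
  pairing = solve 5
    (λ t a b c d → (a :+ t :* (c :- a)) :- (b :+ t :* (d :- b))
                  := (a :- b) :+ t :* ((c :- d) :- (a :- b))) refl
  pairing-along : ∀ t i → ⟨ along v t y ,α i ⟩ ≡ ⟨ v ,α i ⟩ + t * h i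
  pairing-along t i = pairing t (v (inject₁ i)) (v (fsuc i)) (y (inject₁ i)) (y (fsuc i))
  negate : ∀ g ε h → g + ε * (- h) ≡ g + (- ε) * h
  negate = solve 3 (λ g ε h → g :+ ε :* (:- h) := g :+ (:- ε) :* h) refl
  both-directions : ∀ {ε} → 0ℚ ≤ ε → (∀ i → ε * ∣ h i ∣ ≤ ⟨ v ,α i ⟩) →
    ∀ i → 0ℚ ≤ ⟨ along v ε y ,α i ⟩ × 0ℚ ≤ ⟨ along v (- ε) y ,α i ⟩
  both-directions {ε} 0≤ε bounded i =
    subst (0ℚ ≤_) (sym (pairing-along ε i)) (ε∣h∣≤g⇒0≤g+εh 0≤ε (bounded i)) ,
    subst (0ℚ ≤_) (trans (negate ⟨ v ,α i ⟩ ε (h i)) (sym (pairing-along (- ε) i)))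
      (ε∣h∣≤g⇒0≤g+εh 0≤ε (subst (λ a → ε * a ≤ ⟨ v ,α i ⟩) (sym (∣-p∣≡∣p∣ (h i))) (bounded i)))

vertex-rigid : ∀ {n} {λ' v y : Pt n} {ε} → IsVertexP⁺ λ' v → 0ℚ < ε →
  InP⁺ λ' (along v ε y) → InP⁺ λ' (along v (- ε) y) → y ≋ v
vertex-rigid {v = v} {y} {ε} (_ , extreme) 0<ε toward away k =
  x∙y⁻¹≈ε⇒x≈y (y k) (v k) (0<p⇒p*q≡0⇒q≡0 0<ε (begin
    ε * (y k - v k)                                               ≡⟨ difference (v k) ε (y k - v k) ⟩
    ½ * ((v k + ε * (y k - v k)) - (v k + (- ε) * (y k - v k)))   ≡⟨ cong (λ a → ½ * (a - (v k + (- ε) * (y k - v k)))) (toward≋away k) ⟩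
    ½ * ((v k + (- ε) * (y k - v k)) - (v k + (- ε) * (y k - v k))) ≡⟨ cong (½ *_) (+-inverseʳ (v k + (- ε) * (y k - v k))) ⟩
    ½ * 0ℚ                                                        ≡⟨ *-zeroʳ ½ ⟩
    0ℚ                                                            ∎))
  where
  open ≡-Reasoning
  difference : ∀ x ε d → ε * d ≡ ½ * ((x + ε * d) - (x + (- ε) * d))
  difference = solve 3 (λ x ε d → ε :* d := con ½ :* ((x :+ ε :* d) :- (x :+ (:- ε) :* d))) refl
  midpoint : ∀ x ε d → x ≡ ½ * (x + ε * d) + (1ℚ - ½) * (x + (- ε) * d)
  midpoint = solve 3 (λ x ε d → x := con ½ :* (x :+ ε :* d) :+ (con 1ℚ :- con ½) :* (x :+ (:- ε) :* d)) refl
  ½<1 : ½ < 1ℚ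
  ½<1 = *<* (ℤ.+<+ (ℕ.s≤s (ℕ.s≤s ℕ.z≤n)))
  toward≋away : along v ε y ≋ along v (- ε) y
  toward≋away = extreme _ _ ½ toward away (positive⁻¹ ½) ½<1 (λ k → midpoint (v k) ε (y k - v k))

vertex-symmetrised : ∀ {n} {λ' v : Pt n} → InE λ' → IsVertexP⁺ λ' v → ∃ λ σ → symmetrise v (act σ λ') ≋ v
vertex-symmetrised {λ' = λ'} {v} λ∈E vertex@((v∈P , _ , v-dominant) , _) with InP-extrapolate λ' v∈P
... | σ , c , 0<c , extrapolated = σ , vertex-rigid vertex 0<ε (toward , InP⇒InE λ' λ∈E toward , proj₁ ∘ chamber)
                                                           (away , InP⇒InE λ' λ∈E away , proj₂ ∘ chamber)
  where
  y = symmetrise v (act σ λ')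
  ties : ∀ i → ⟨ v ,α i ⟩ ≡ 0ℚ → ⟨ y ,α i ⟩ ≡ 0ℚ
  ties i vᵢ-vᵢ₊₁≡0 = trans (cong (_- y (fsuc i)) (symmetrise-equalises v (act σ λ') vᵢ≡vᵢ₊₁)) (+-inverseʳ (y (fsuc i)))
    where vᵢ≡vᵢ₊₁ = x∙y⁻¹≈ε⇒x≈y (v (inject₁ i)) (v (fsuc i)) vᵢ-vᵢ₊₁≡0
  ε-choice = ForSmall-× (ForSmall-× (ForSmall-≤ 0<c) (ForSmall-≤ (positive⁻¹ 1ℚ))) (chamber-perturbation v y v-dominant ties)
  ε = proj₁ ε-choice
  0<ε = proj₁ (proj₂ ε-choice)
  0≤ε = <⇒≤ 0<ε
  small = proj₂ (proj₂ ε-choice) ε 0≤ε ≤-refl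
  ε≤c : ε ≤ c
  ε≤c = proj₁ (proj₁ small)
  ε≤1 : ε ≤ 1ℚ
  ε≤1 = proj₂ (proj₁ small)
  chamber : ∀ i → 0ℚ ≤ ⟨ along v ε y ,α i ⟩ × 0ℚ ≤ ⟨ along v (- ε) y ,α i ⟩
  chamber = proj₂ small
  toward : InP λ' (along v ε y)
  toward = InP-along λ' 0≤ε ε≤1 v∈P (symmetrise-InP v λ' (InP-orbit λ' σ))
  symmetrised-away : symmetrise v (along v (- ε) (act σ λ')) ≋ along v (- ε) y
  symmetrised-away k = trans (symmetrise-along v v (- ε) (act σ λ') k)
                             (along-cong {y = y} {y′ = y} (- ε) (symmetrise-fixes v) (λ _ → refl) k)
  away : InP λ' (along v (- ε) y)
  away = InP-cong λ' symmetrised-away (symmetrise-InP v λ' (extrapolated ε 0≤ε ε≤c))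

-- x = Σᵢ xᵢ (εᵢ − ε₀), because Σᵢ xᵢ = 0.
InE⇒InZInvΦ : ∀ {n} N {x : Pt n} → InE x → (∀ k → InZInv N (x k)) → InZInvΦ N x
InE⇒InZInvΦ {n} N {x} x∈E coordinates = c , c∈ , x≋
  where
  c : Fin (suc n) → Fin (suc n) → ℚ
  c i fzero = x i
  c i (fsuc _) = 0ℚ
  c∈ : ∀ i j → InZInv N (c i j)
  c∈ i fzero = coordinates i
  c∈ i (fsuc j) = InZInv-ℤ N (ℤ.+ 0)
  open ≡-Reasoning
  row : ∀ k i → Σᶠ (λ j → c i j * root i j k) ≡ x i * δ i k + (- δ {suc n} fzero k) * x i
  row k i = begin
    x i * root i fzero k + Σᶠ (λ j → 0ℚ * root i (fsuc j) k) ≡⟨ cong (x i * root i fzero k +_) (trans (Σᶠ-cong (λ j → *-zeroˡ (root i (fsuc j) k))) (Σᶠ-zero {n})) ⟩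
    x i * root i fzero k + 0ℚ                                  ≡⟨ expand (x i) (δ i k) (δ {suc n} fzero k) ⟩
    x i * δ i k + (- δ {suc n} fzero k) * x i                  ∎
    where
    expand : ∀ a d₁ d₀ → a * (d₁ - d₀) + 0ℚ ≡ a * d₁ + (- d₀) * a
    expand = solve 3 (λ a d₁ d₀ → a :* (d₁ :- d₀) :+ con 0ℚ := a :* d₁ :+ (:- d₀) :* a) refl
  x≋ : x ≋ (λ k → Σᶠ (λ i → Σᶠ (λ j → c i j * root i j k)))
  x≋ k = sym (begin
    Σᶠ (λ i → Σᶠ (λ j → c i j * root i j k))                            ≡⟨ Σᶠ-cong (row k) ⟩
    Σᶠ (λ i → x i * δ i k + (- δ {suc n} fzero k) * x i)               ≡⟨ Σᶠ-distrib-+ (λ i → x i * δ i k) (λ i → (- δ {suc n} fzero k) * x i) ⟩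
    Σᶠ (λ i → x i * δ i k) + Σᶠ (λ i → (- δ {suc n} fzero k) * x i)    ≡⟨ cong₂ _+_ (Σᶠ-δ x k) (Σᶠ-distribˡ-* (- δ {suc n} fzero k) x) ⟩
    x k + (- δ {suc n} fzero k) * Σᶠ x                                 ≡⟨ cong (λ s → x k + (- δ {suc n} fzero k) * s) x∈E ⟩
    x k + (- δ {suc n} fzero k) * 0ℚ                                   ≡⟨ cong (x k +_) (*-zeroʳ (- δ {suc n} fzero k)) ⟩
    x k + 0ℚ                                                           ≡⟨ +-identityʳ (x k) ⟩
    x k                                                                ∎)

corollary5p5 : (n : ℕ) → (λ' v : Pt n) → DominantWeight λ' → IsVertexP⁺ λ' v →
    InZInvΦ ((suc n) !) v
corollary5p5 n λ' v dominant vertex = InE⇒InZInvΦ N {v} v∈E v-coordinates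
  where
  N = (suc n) !
  v∈E = InP⇒InE λ' (proj₁ dominant) (proj₁ (proj₁ vertex))
  symmetrised = vertex-symmetrised (proj₁ dominant) vertex
  σ = proj₁ symmetrised
  λ-coordinates : ∀ p → InZInv N (act σ λ' p)
  λ-coordinates p = dominant-InZInv N (m∣m*n (n !)) {λ'} dominant (σ ⟨$⟩ʳ p)
  v-coordinates : ∀ k → InZInv N (v k)
  v-coordinates k = subst (InZInv N) (proj₂ symmetrised k) (symmetrise-InZInv v {act σ λ'} λ-coordinates k)
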